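{- Let $G=(V,E\cup A)$ be a mixed graph and $F\subseteq E\cup A$. Then $F$ is a mixed edge cover if and only if $F\cap A$ contains a branching $B$ such that $R(B)\subseteq \mathrm{cov}(F\cap E)$.
   Context: A mixed graph $G=(V,E\cup A)$ has a finite vertex set $V$, undirected edges $E$ and directed arcs $A$; no loops, parallel edges/arcs allowed. For $F\subseteq E\cup A$, $\mathrm{cov}(F)$ denotes the set of vertices that are an endpoint of some edge in $F$ or the head of some arc in $F$. A branching is an arc set $B\subseteq A$ with no directed cycle in which every vertex is the head of at most one arc; its root set is $R(B):=V\setminus \mathrm{cov}(B)$. A mixed edge cover is a subset $F\subseteq E\cup A$ such that for every $v\in V$ there is a directed path (possibly of length $0$) using only arcs of $F\cap A$ from an endpoint of some edge of $F\cap E$ to $v$. -}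

module Defs where

open import Data.Nat using (ℕ)
open import Data.Fin using (Fin)
open import Data.Fin.Subset using (Subset; _∈_; _⊆_)
open import Data.Product using (Σ; ∃; _×_; _,_)
open import Data.Sum using (_⊎_)
open import Relation.Binary.PropositionalEquality using (_≡_; _≢_)
open import Relation.Nullary using (¬_)

-- Parallel edges/arcs are allowed
-- (distinct indices may have the same endpoints); loops are forbidden.
record MixedGraph : Set where
  field
    nV nE nA : ℕ
    end₁ end₂ : Fin nE → Fin nV
    tail head : Fin nA → Fin nV
    edge-noloop : ∀ e → end₁ e ≢ end₂ e
    arc-noloop  : ∀ a → tail a ≢ head a

module _ (G : MixedGraph) where
  open MixedGraph G

  -- A subset F ⊆ E ∪ A is given by its two parts F ∩ E and F ∩ A.
  record EdgeArcSet : Set where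
    constructor ⟨_,_⟩
    field
      edgesOf : Subset nE
      arcsOf  : Subset nA

  _∈covE_ : Fin nV → Subset nE → Set
  v ∈covE S = ∃ λ e → e ∈ S × (v ≡ end₁ e ⊎ v ≡ end₂ e)

  _∈covA_ : Fin nV → Subset nA → Set
  v ∈covA B = ∃ λ a → a ∈ B × head a ≡ v

  data Path (S : Subset nA) : Fin nV → Fin nV → Set where
    here  : ∀ {u} → Path S u u
    there : ∀ {v} a → a ∈ S → Path S (head a) v → Path S (tail a) v

  -- a branching: arc set with no directed cycle, every vertex head of ≤ 1 arc
  -- (a directed cycle exists iff some arc a ∈ B has a B-path from head a back to tail a)
  record IsBranching (B : Subset nA) : Set where
    field
      acyclic    : ∀ a → a ∈ B → ¬ Path B (head a) (tail a)
      in-deg-≤1  : ∀ a a' → a ∈ B → a' ∈ B → head a ≡ head a' → a ≡ a'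

  _∈Roots_ : Fin nV → Subset nA → Set
  v ∈Roots B = ¬ (v ∈covA B)

  IsMixedEdgeCover : EdgeArcSet → Set
  IsMixedEdgeCover F =
    ∀ v → ∃ λ u → u ∈covE EdgeArcSet.edgesOf F × Path (EdgeArcSet.arcsOf F) u v

-- Backward: in an acyclic arc set, following arcs backwards from v must stop
-- within |V| steps (a longer backward walk repeats a vertex and closes a
-- cycle), and it can only stop at a root; so every vertex is reached from a
-- root, and roots are covered by F ∩ E.
-- Forward: let dist v be the least number of arcs of F ∩ A on a walk from
-- cov(F ∩ E) to v. Every vertex with dist v > 0 picks one arc a into v with
-- dist (tail a) < dist v; these arcs form a branching, since dist strictly
-- increases along them, and its roots are exactly the vertices at distance 0.
module Submission where

open import Data.Empty using (⊥-elim)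
open import Data.Fin using (Fin; zero; suc; _≟_) renaming (_<_ to _<ᶠ_)
open import Data.Fin.Properties using (any?; pigeonhole)
open import Data.Fin.Subset using (Subset; _⊆_; _∈_)
open import Data.Fin.Subset.Properties using (_∈?_)
open import Data.Maybe using (Maybe; just; nothing)
open import Data.Maybe.Properties using (just-injective) renaming (≡-dec to ≡-decMaybe)
open import Data.Nat using (ℕ; zero; suc; _≤_; _<_; s≤s)
open import Data.Nat.Properties using (≤-refl; ≤-trans; <⇒≤; <⇒≱; ≮⇒≥; n<1+n; anyUpTo?)
open import Data.Nat.Induction using (<-wellFounded)
open import Data.Product using (Σ; ∃; _×_; _,_; proj₁; proj₂)
open import Data.Sum using (_⊎_; inj₁; inj₂)
open import Data.Unit using (⊤; tt)
open import Data.Vec using (tabulate)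
open import Data.Vec.Properties using (lookup∘tabulate; []=⇒lookup; lookup⇒[]=)
open import Defs
open import Function.Bundles using (_⇔_; mk⇔)
open import Induction.WellFounded using (Acc; acc)
open import Relation.Binary.PropositionalEquality using (_≡_; refl; sym; trans; cong; subst)
open import Relation.Nullary using (¬_; yes; no; does)
open import Relation.Nullary.Decidable using (_×-dec_; _⊎-dec_; map′; dec-true)
open import Relation.Unary using (Pred; Decidable)

least-witness : ∀ {p} {P : Pred ℕ p} → Decidable P → ∀ {n} → P n →
                ∃ λ m → P m × (∀ {k} → P k → m ≤ k)
least-witness {P = P} P? = go (<-wellFounded _)
  where
  go : ∀ {n} → Acc _<_ n → P n → ∃ λ m → P m × (∀ {k} → P k → m ≤ k)
  go {n} (acc smaller) Pn with anyUpTo? P? n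
  ... | yes (k , k<n , Pk) = go (smaller k<n) Pk
  ... | no none = n , Pn , λ {k} Pk → ≮⇒≥ λ k<n → none (k , k<n , Pk)

subsetOf : ∀ {n p} {P : Pred (Fin n) p} → Decidable P → Subset n
subsetOf P? = tabulate λ i → does (P? i)

∈-subsetOf⁺ : ∀ {n p} {P : Pred (Fin n) p} (P? : Decidable P) {i} → P i → i ∈ subsetOf P?
∈-subsetOf⁺ P? {i} Pi =
  lookup⇒[]= i (subsetOf P?) (trans (lookup∘tabulate _ i) (dec-true (P? i) Pi))

∈-subsetOf⁻ : ∀ {n p} {P : Pred (Fin n) p} (P? : Decidable P) {i} → i ∈ subsetOf P? → P i
∈-subsetOf⁻ P? {i} i∈ with P? i | trans (sym (lookup∘tabulate (λ j → does (P? j)) i)) ([]=⇒lookup i∈)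
... | yes Pi | _ = Pi
... | no _   | ()

module _ (G : MixedGraph) where
  open MixedGraph G

  Acyclic : Subset nA → Set
  Acyclic S = ∀ a → a ∈ S → ¬ Path G S (head a) (tail a)

  Path-++ : ∀ {S x y z} → Path G S x y → Path G S y z → Path G S x z
  Path-++ here          q = q
  Path-++ (there a a∈ p) q = there a a∈ (Path-++ p q)

  Path-∷ʳ : ∀ {S x a} → Path G S x (tail a) → a ∈ S → Path G S x (head a)
  Path-∷ʳ p a∈ = Path-++ p (there _ a∈ here)

  Path-mono : ∀ {S T x y} → S ⊆ T → Path G S x y → Path G T x y
  Path-mono S⊆T here          = here
  Path-mono S⊆T (there a a∈ p) = there a (S⊆T a∈) (Path-mono S⊆T p)

  Path⁺ : Subset nA → Fin nV → Fin nV → Set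
  Path⁺ S x y = ∃ λ a → a ∈ S × tail a ≡ x × Path G S (head a) y

  Path-++⁺ : ∀ {S x y a} → Path G S x (tail a) → a ∈ S → Path G S (head a) y → Path⁺ S x y
  Path-++⁺ {a = a} here          a∈ q = a , a∈ , refl , q
  Path-++⁺ (there a′ a′∈ p) a∈ q = a′ , a′∈ , refl , Path-++ p (there _ a∈ q)

  Acyclic⇒¬closedPath⁺ : ∀ {S x} → Acyclic S → ¬ Path⁺ S x x
  Acyclic⇒¬closedPath⁺ acyclic (a , a∈ , refl , p) = acyclic a a∈ p

  potential⇒Acyclic : ∀ {S} (f : Fin nV → ℕ) →
                      (∀ {a} → a ∈ S → f (tail a) < f (head a)) → Acyclic S
  potential⇒Acyclic {S} f increasing a a∈ p = <⇒≱ (increasing a∈) (Path⇒≤ p)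
    where
    Path⇒≤ : ∀ {x y} → Path G S x y → f x ≤ f y
    Path⇒≤ here           = ≤-refl
    Path⇒≤ (there _ a∈ p) = ≤-trans (<⇒≤ (increasing a∈)) (Path⇒≤ p)

  ∈covE? : ∀ S → Decidable (λ v → _∈covE_ G v S)
  ∈covE? S v = any? λ e → e ∈? S ×-dec (v ≟ end₁ e ⊎-dec v ≟ end₂ e)

  ∈covA? : ∀ S → Decidable (λ v → _∈covA_ G v S)
  ∈covA? S v = any? λ a → a ∈? S ×-dec head a ≟ v

  data WalkFrom (P : Fin nV → Set) (S : Subset nA) : ℕ → Fin nV → Set where
    start : ∀ {v} → P v → WalkFrom P S zero v
    step  : ∀ {k} a → a ∈ S → WalkFrom P S k (tail a) → WalkFrom P S (suc k) (head a)

  WalkFrom? : ∀ {P} → Decidable P → ∀ S k → Decidable (WalkFrom P S k)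
  WalkFrom? P? S zero    v = map′ start (λ { (start Pv) → Pv }) (P? v)
  WalkFrom? P? S (suc k) v =
    map′ (λ { (a , a∈ , refl , w) → step a a∈ w }) (λ { (step a a∈ w) → a , a∈ , refl , w })
         (any? λ a → a ∈? S ×-dec (head a ≟ v ×-dec WalkFrom? P? S k (tail a)))

  WalkFrom-++ : ∀ {P S k u v} → WalkFrom P S k u → Path G S u v → ∃ λ m → WalkFrom P S m v
  WalkFrom-++ w here           = _ , w
  WalkFrom-++ w (there a a∈ p) = WalkFrom-++ (step a a∈ w) p

  -- vertex w i is the vertex i steps before the end of w.
  vertex : ∀ {P S k v} → WalkFrom P S k v → Fin (suc k) → Fin nV
  vertex {v = v} w          zero    = v
  vertex (step _ _ w) (suc i) = vertex w i

  vertex-Path : ∀ {P S k v} (w : WalkFrom P S k v) i → Path G S (vertex w i) v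
  vertex-Path w zero = here
  vertex-Path (step a a∈ w) (suc i) = Path-∷ʳ (vertex-Path w i) a∈

  vertex-Path⁺ : ∀ {P S k v} (w : WalkFrom P S k v) {i j} → i <ᶠ j →
                 Path⁺ S (vertex w j) (vertex w i)
  vertex-Path⁺ (step a a∈ w) {zero}  {suc j} _         = Path-++⁺ (vertex-Path w j) a∈ here
  vertex-Path⁺ (step a a∈ w) {suc i} {suc j} (s≤s i<j) = vertex-Path⁺ w i<j

  Acyclic⇒¬WalkFrom-nV : ∀ {P S v} → Acyclic S → ¬ WalkFrom P S nV v
  Acyclic⇒¬WalkFrom-nV acyclic w with pigeonhole (n<1+n nV) (vertex w)
  ... | i , j , i<j , same = Acyclic⇒¬closedPath⁺ acyclic
    (subst (λ x → Path⁺ _ x (vertex w i)) (sym same) (vertex-Path⁺ w i<j))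

  rooted⊎WalkFrom : ∀ S k v →
                    (∃ λ u → _∈Roots_ G u S × Path G S u v) ⊎ WalkFrom (λ _ → ⊤) S k v
  rooted⊎WalkFrom S zero    v = inj₂ (start tt)
  rooted⊎WalkFrom S (suc k) v with ∈covA? S v
  ... | no root = inj₁ (v , root , here)
  ... | yes (a , a∈ , refl) with rooted⊎WalkFrom S k (tail a)
  ...   | inj₁ (u , root , p) = inj₁ (u , root , Path-∷ʳ p a∈)
  ...   | inj₂ w              = inj₂ (step a a∈ w)

  Acyclic⇒rooted : ∀ S → Acyclic S → ∀ v → ∃ λ u → _∈Roots_ G u S × Path G S u v
  Acyclic⇒rooted S acyclic v with rooted⊎WalkFrom S nV v
  ... | inj₁ rooted = rooted
  ... | inj₂ w      = ⊥-elim (Acyclic⇒¬WalkFrom-nV acyclic w)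

  module ShortestPathBranching {C : Fin nV → Set} (C? : Decidable C) (S : Subset nA)
           (reachable : ∀ v → ∃ λ u → C u × Path G S u v) where

    shortest : ∀ v → ∃ λ d → WalkFrom C S d v × (∀ {k} → WalkFrom C S k v → d ≤ k)
    shortest v with reachable v
    ... | u , Cu , p with WalkFrom-++ (start Cu) p
    ...   | _ , w = least-witness (λ k → WalkFrom? C? S k v) w

    dist : Fin nV → ℕ
    dist v = proj₁ (shortest v)

    dist-minimal : ∀ {k v} → WalkFrom C S k v → dist v ≤ k
    dist-minimal {v = v} = proj₂ (proj₂ (shortest v))

    parent : Fin nV → Maybe (Fin nA)
    parent v with shortest v
    ... | zero  , _            , _ = nothing
    ... | suc _ , step a _ _ , _ = just a

    parent-nothing : ∀ v → parent v ≡ nothing → C v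
    parent-nothing v eq with shortest v
    parent-nothing v refl | zero , start Cv , _ = Cv

    parent-just : ∀ v a → parent v ≡ just a → a ∈ S × head a ≡ v × dist (tail a) < dist v
    parent-just v a eq with shortest v
    parent-just v a refl | suc _ , step a a∈ w , _ = a∈ , refl , s≤s (dist-minimal w)

    IsParentArc : Fin nA → Set
    IsParentArc a = parent (head a) ≡ just a

    IsParentArc? : Decidable IsParentArc
    IsParentArc? a = ≡-decMaybe _≟_ (parent (head a)) (just a)

    tree : Subset nA
    tree = subsetOf IsParentArc?

    tree-parent : ∀ {a} → a ∈ tree → IsParentArc a
    tree-parent = ∈-subsetOf⁻ IsParentArc?

    tree⊆S : tree ⊆ S
    tree⊆S a∈ = proj₁ (parent-just _ _ (tree-parent a∈))

    dist-increasing : ∀ {a} → a ∈ tree → dist (tail a) < dist (head a)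
    dist-increasing a∈ = proj₂ (proj₂ (parent-just _ _ (tree-parent a∈)))

    tree-isBranching : IsBranching G tree
    tree-isBranching = record
      { acyclic   = potential⇒Acyclic dist dist-increasing
      ; in-deg-≤1 = λ a a′ a∈ a′∈ same-head →
          just-injective (trans (sym (tree-parent a∈)) (trans (cong parent same-head) (tree-parent a′∈)))
      }

    tree-roots : ∀ v → _∈Roots_ G v tree → C v
    tree-roots v root with parent v in eq
    ... | nothing = parent-nothing v eq
    ... | just a with parent-just v a eq
    ...   | _ , refl , _ = ⊥-elim (root (a , ∈-subsetOf⁺ IsParentArc? eq , refl))

    branching : Σ (Subset nA) λ B → B ⊆ S × IsBranching G B × (∀ v → _∈Roots_ G v B → C v)
    branching = tree , tree⊆S , tree-isBranching , tree-roots

  MixedEdgeCover⇒branching : ∀ F → IsMixedEdgeCover G F →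
    Σ (Subset nA) λ B → B ⊆ EdgeArcSet.arcsOf F × IsBranching G B ×
      (∀ v → _∈Roots_ G v B → _∈covE_ G v (EdgeArcSet.edgesOf F))
  MixedEdgeCover⇒branching ⟨ FE , FA ⟩ cover =
    ShortestPathBranching.branching (∈covE? FE) FA cover

  branching⇒MixedEdgeCover : ∀ F →
    (Σ (Subset nA) λ B → B ⊆ EdgeArcSet.arcsOf F × IsBranching G B ×
      (∀ v → _∈Roots_ G v B → _∈covE_ G v (EdgeArcSet.edgesOf F))) →
    IsMixedEdgeCover G F
  branching⇒MixedEdgeCover F (B , B⊆FA , branching , roots-covered) v
    with Acyclic⇒rooted B (IsBranching.acyclic branching) v
  ... | u , root , p = u , roots-covered u root , Path-mono B⊆FA p

proposition2 : (G : MixedGraph) → (F : EdgeArcSet G) →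
    IsMixedEdgeCover G F ⇔
      Σ (Subset (MixedGraph.nA G)) (λ B → (B ⊆ EdgeArcSet.arcsOf F) × IsBranching G B ×
        (∀ v → _∈Roots_ G v B → _∈covE_ G v (EdgeArcSet.edgesOf F)))
proposition2 G F = mk⇔ (MixedEdgeCover⇒branching G F) (branching⇒MixedEdgeCover G F)
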